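{- Let $n\ge k\ge1$ and let $p,q\in\phi(n,k)$ be such that $p$ is a major motif and $p[1]=q[1]$. Then $p\succeq q$.
   Context: A motif of $n$ is a finite non-increasing sequence $p=(p[1],\dots,p[k])$ of positive integers with sum $n$; $\phi(n,k)$ is the set of motifs of $n$ of length $k$. For motifs $p,q$ of $n$, $p\succeq q$ means $\sum_{x=1}^t p[x]\ge\sum_{x=1}^t q[x]$ for every $1\le t\le\min(|p|,|q|)$. A motif $p\in\phi(n,k)$ is major if there is an integer $\lambda$ with $\lceil n/k\rceil\le\lambda\le n-k+1$ and $\lambda\ge2$ such that, writing $\beta=\lfloor (n-k)/(\lambda-1)\rfloor$, one has $p[x]=\lambda$ for $1\le x\le\beta$, $p[\beta+1]=n-\beta\lambda-(k-\beta-1)$ (when $\beta+1\le k$), and $p[x]=1$ for $\beta+1<x\le k$. -}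

module Defs where

open import Data.Nat using (ℕ; zero; suc; _+_; _*_; _∸_; _≤_; _<_; _≥_; _/_)
open import Data.List using (List; []; _∷_; length; take)
open import Data.Nat.ListAction using (sum)
open import Data.List.Relation.Unary.All using (All)
open import Data.List.Relation.Unary.Linked using (Linked)
open import Data.Product using (Σ; _×_)
open import Relation.Binary.PropositionalEquality using (_≡_)

-- 1-based indexing into a list, p[x]; value 0 outside 1..length p (never used there).
_[_] : List ℕ → ℕ → ℕ
[] [ _ ] = 0
(a ∷ p) [ zero ] = 0
(a ∷ p) [ suc zero ] = a
(a ∷ p) [ suc (suc x) ] = p [ suc x ]

IsMotif : ℕ → ℕ → List ℕ → Set
IsMotif n k p = length p ≡ k × All (λ a → 1 ≤ a) p × Linked _≥_ p × sum p ≡ n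

_⪰_ : List ℕ → List ℕ → Set
p ⪰ q = (t : ℕ) → 1 ≤ t → t ≤ length p → t ≤ length q → sum (take t q) ≤ sum (take t p)

-- major motif condition (p assumed to be in φ(n,k)).
-- ⌈n/k⌉ ≤ λ is written as n ≤ k * λ (equivalent for k ≥ 1).
IsMajor : ℕ → ℕ → List ℕ → Set
-- λ ≥ 2 is encoded by writing λ = 2 + m, so that λ - 1 = suc m is a nonzero divisor.
IsMajor n k p = Σ ℕ λ m → let l = 2 + m in
  (n ≤ k * l) × (l ≤ n ∸ k + 1) ×
  (let β = (n ∸ k) / suc m in
    ((x : ℕ) → 1 ≤ x → x ≤ β → x ≤ k → p [ x ] ≡ l) ×
    (β + 1 ≤ k → p [ β + 1 ] ≡ n ∸ β * l ∸ (k ∸ β ∸ 1)) ×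
    ((x : ℕ) → β + 1 < x → x ≤ k → p [ x ] ≡ 1))

-- If the prefix of length t lies in the plateau of p (t ≤ β), it sums to t·λ, while the
-- non-increasing q with q[1] = λ has prefix sums at most t·λ.  Otherwise the remainder of p
-- after position t consists of ones, so it sums to k − t, which is at most the sum of the
-- remainder of q (whose entries are positive); since p and q have the same total n, the
-- prefix of q can only be the smaller one.
module Submission where

open import Defs
open import Data.Nat using (ℕ; zero; suc; _+_; _*_; _∸_; _≤_; _<_; _≥_; z≤n; s≤s; _≤?_; _/_)
open import Data.Nat.Properties
open import Data.Nat.ListAction using (sum)
open import Data.Nat.ListAction.Properties using (sum-++)
open import Data.List using (List; []; _∷_; length; take; drop)
open import Data.List.Properties using (length-take; length-drop; take++drop≡id)
open import Data.List.Relation.Unary.All using (All; []; _∷_)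
open import Data.List.Relation.Unary.All.Properties using (drop⁺)
open import Data.List.Relation.Unary.Linked using (Linked; []; _∷_)
open import Data.Product using (_,_)
open import Relation.Nullary using (yes; no)
open import Relation.Binary.PropositionalEquality
  using (_≡_; refl; sym; trans; cong; subst)

[]-∷ : ∀ (a : ℕ) xs {x} → 1 ≤ x → (a ∷ xs) [ suc x ] ≡ xs [ x ]
[]-∷ a xs {suc x} _ = refl

take-[] : ∀ t (xs : List ℕ) {x} → x ≤ t → take t xs [ x ] ≡ xs [ x ]
take-[] zero    []       z≤n = refl
take-[] zero    (a ∷ xs) z≤n = refl
take-[] (suc t) []       _   = refl
take-[] (suc t) (a ∷ xs) {zero}        _         = refl
take-[] (suc t) (a ∷ xs) {suc zero}    _         = refl
take-[] (suc t) (a ∷ xs) {suc (suc x)} (s≤s x≤t) = take-[] t xs x≤t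

drop-[] : ∀ t (xs : List ℕ) {x} → 1 ≤ x → drop t xs [ x ] ≡ xs [ t + x ]
drop-[] zero    xs       _   = refl
drop-[] (suc t) []       _   = refl
drop-[] (suc t) (a ∷ xs) {x} x≥1 =
  trans (drop-[] t xs x≥1) (sym ([]-∷ a xs (≤-trans x≥1 (m≤n+m x t))))

All-[] : ∀ {p} {P : ℕ → Set p} (ys : List ℕ) →
  (∀ x → 1 ≤ x → x ≤ length ys → P (ys [ x ])) → All P ys
All-[] []       _  = []
All-[] {P = P} (a ∷ ys) Pys = Pys 1 ≤-refl (s≤s z≤n) ∷ All-[] ys λ x x≥1 x≤ →
  subst P ([]-∷ a ys x≥1) (Pys (suc x) (m≤n⇒m≤1+n x≥1) (s≤s x≤))

sum-constant : ∀ {l} (ys : List ℕ) → All (_≡ l) ys → sum ys ≡ length ys * l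
sum-constant []       []           = refl
sum-constant (a ∷ ys) (refl ∷ ys≡l) = cong (a +_) (sum-constant ys ys≡l)

length≤sum : ∀ (ys : List ℕ) → All (1 ≤_) ys → length ys ≤ sum ys
length≤sum []       []           = z≤n
length≤sum (a ∷ ys) (a≥1 ∷ ys≥1) = +-mono-≤ a≥1 (length≤sum ys ys≥1)

sum-take≤*head : ∀ t (ys : List ℕ) {h} → Linked _≥_ ys → ys [ 1 ] ≤ h → sum (take t ys) ≤ t * h
sum-take≤*head zero    ys           _            _   = z≤n
sum-take≤*head (suc t) []           _            _   = z≤n
sum-take≤*head (suc t) (a ∷ [])     _            a≤h = +-mono-≤ a≤h (sum-take≤*head t [] [] z≤n)
sum-take≤*head (suc t) (a ∷ b ∷ ys) (a≥b ∷ ↓ys) a≤h =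
  +-mono-≤ a≤h (sum-take≤*head t (b ∷ ys) ↓ys (≤-trans a≥b a≤h))

sum-take+sum-drop : ∀ t (ys : List ℕ) → sum (take t ys) + sum (drop t ys) ≡ sum ys
sum-take+sum-drop t ys = trans (sym (sum-++ (take t ys) (drop t ys))) (cong sum (take++drop≡id t ys))

sum-take-≤-from-sum-drop-≥ : ∀ t (p q : List ℕ) → sum p ≡ sum q →
  sum (drop t p) ≤ sum (drop t q) → sum (take t q) ≤ sum (take t p)
sum-take-≤-from-sum-drop-≥ t p q Σp≡Σq dp≤dq = +-cancelʳ-≤ (sum (drop t p)) _ _ (begin
  sum (take t q) + sum (drop t p) ≤⟨ +-monoʳ-≤ (sum (take t q)) dp≤dq ⟩
  sum (take t q) + sum (drop t q) ≡⟨ sum-take+sum-drop t q ⟩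
  sum q                           ≡⟨ sym Σp≡Σq ⟩
  sum p                           ≡⟨ sym (sum-take+sum-drop t p) ⟩
  sum (take t p) + sum (drop t p) ∎)
  where open ≤-Reasoning

sum-take-≤-on-plateau : ∀ t l (p q : List ℕ) → t ≤ length p →
  (∀ x → 1 ≤ x → x ≤ t → p [ x ] ≡ l) → Linked _≥_ q → q [ 1 ] ≤ l →
  sum (take t q) ≤ sum (take t p)
sum-take-≤-on-plateau t l p q t≤|p| plateau ↓q q₁≤l = begin
  sum (take t q)              ≤⟨ sum-take≤*head t q ↓q q₁≤l ⟩
  t * l                       ≡⟨ cong (_* l) (sym |take|≡t) ⟩
  length (take t p) * l       ≡⟨ sym (sum-constant (take t p) (All-[] (take t p) take≡l)) ⟩
  sum (take t p)              ∎
  where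
  open ≤-Reasoning
  |take|≡t : length (take t p) ≡ t
  |take|≡t = trans (length-take t p) (m≤n⇒m⊓n≡m t≤|p|)
  take≡l : ∀ x → 1 ≤ x → x ≤ length (take t p) → take t p [ x ] ≡ l
  take≡l x x≥1 x≤ = let x≤t = subst (x ≤_) |take|≡t x≤ in
    trans (take-[] t p x≤t) (plateau x x≥1 x≤t)

sum-take-≤-on-tail-of-ones : ∀ t (p q : List ℕ) → t ≤ length p →
  length p ≡ length q → sum p ≡ sum q → All (1 ≤_) q →
  (∀ x → t < x → x ≤ length p → p [ x ] ≡ 1) →
  sum (take t q) ≤ sum (take t p)
sum-take-≤-on-tail-of-ones t p q t≤|p| |p|≡|q| Σp≡Σq q≥1 ones =
  sum-take-≤-from-sum-drop-≥ t p q Σp≡Σq (begin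
    sum (drop t p)            ≡⟨ sum-constant (drop t p) (All-[] (drop t p) drop≡1) ⟩
    length (drop t p) * 1     ≡⟨ *-identityʳ _ ⟩
    length (drop t p)         ≡⟨ trans (length-drop t p) (cong (_∸ t) |p|≡|q|) ⟩
    length q ∸ t              ≡⟨ sym (length-drop t q) ⟩
    length (drop t q)         ≤⟨ length≤sum (drop t q) (drop⁺ t q≥1) ⟩
    sum (drop t q)            ∎)
  where
  open ≤-Reasoning
  drop≡1 : ∀ x → 1 ≤ x → x ≤ length (drop t p) → drop t p [ x ] ≡ 1
  drop≡1 x x≥1 x≤ = trans (drop-[] t p x≥1) (ones (t + x)
    (subst (_≤ t + x) (+-comm t 1) (+-monoʳ-≤ t x≥1))
    (subst (t + x ≤_) (m+[n∸m]≡n t≤|p|) (+-monoʳ-≤ t (subst (x ≤_) (length-drop t p) x≤))))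

mainTheorem7 : (n k : ℕ) → 1 ≤ k → k ≤ n → (p q : List ℕ) →
    IsMotif n k p → IsMotif n k q → IsMajor n k p → p [ 1 ] ≡ q [ 1 ] → p ⪰ q
mainTheorem7 n k k≥1 _ p q (|p|≡k , _ , _ , Σp≡n) (|q|≡k , q≥1 , ↓q , Σq≡n)
             (m , _ , _ , plateau , _ , ones) p₁≡q₁ t t≥1 t≤|p| _
  with t ≤? (n ∸ k) / suc m
... | yes t≤β = sum-take-≤-on-plateau t (2 + m) p q t≤|p|
      (λ x x≥1 x≤t → plateau x x≥1 (≤-trans x≤t t≤β) (≤-trans x≤t t≤k))
      ↓q (≤-reflexive (trans (sym p₁≡q₁) (plateau 1 ≤-refl (≤-trans t≥1 t≤β) k≥1)))
  where t≤k = subst (t ≤_) |p|≡k t≤|p|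
... | no t≰β = sum-take-≤-on-tail-of-ones t p q t≤|p| (trans |p|≡k (sym |q|≡k))
      (trans Σp≡n (sym Σq≡n)) q≥1
      (λ x t<x x≤|p| → ones x (≤-trans (s≤s (subst (_≤ t) (+-comm 1 _) (≰⇒> t≰β))) t<x) (subst (x ≤_) |p|≡k x≤|p|))
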